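{- Let $d\ge3$ be an integer, $V=\{1,\dots,d\}$, and $0<\delta<1$. Let $\mathbf{\Delta}=(\mathbf{\Delta}_2,\dots,\mathbf{\Delta}_d)$ with $\mathbf{\Delta}_\ell=\delta$ for $2\le\ell\le d-1$ and $\mathbf{\Delta}_d=-\infty$. Then $$g\left(\tbinom{V}{2},\mathbf{\Delta}\right)=\max\left\{\delta d-2d+3,\;-\tbinom{d}{2}+\tbinom{d}{2}\delta\right\},$$ and this maximum is achieved by the cover $\mathcal{U}=\{\{1,\dots,d-1\}\}\cup\{\{1,d\},\{2,d\},\dots,\{d-1,d\}\}$ or by the cover $\mathcal{U}=\binom{V}{2}$.
   Context: $\binom{V}{2}$ denotes the set of all 2-element subsets of $V$ (the edge set of the complete graph on $V$). A cover of an edge set $E$ spanning vertex set $V$ is a family $\mathcal{U}\subset 2^V$ such that (i) every $u\in\mathcal{U}$ has $|u|\ge2$ and $E\not\subset\bigcup_{u'\in\mathcal{U}\setminus\{u\}}\binom{u'}{2}$, and (ii) $E\subset\bigcup_{u\in\mathcal{U}}\binom{u}{2}$. For a vector $\mathbf{\Delta}=(\mathbf{\Delta}_2,\dots,\mathbf{\Delta}_{|V|})$ with entries $<1$ (entries $-\infty$ allowed), $g(E,\mathbf{\Delta})=\max_{\mathcal{U}}\sum_{u\in\mathcal{U}}\left(1+\mathbf{\Delta}_{|u|}-|u|\right)$, the maximum over all covers $\mathcal{U}$ of $E$.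
   Formalization: The parameter δ ranges over the rationals, so the entries of Δ take values in the rationals together with −∞. -}

module Defs where

open import Data.Nat using (ℕ; zero; suc; _∸_; _≡ᵇ_; _<_; _≤_)
open import Data.Nat.Combinatorics using (_C_)
open import Data.Bool using (Bool; true; false; _∨_; if_then_else_)
open import Data.Fin using (Fin; toℕ)
open import Data.Fin.Subset using (Subset; _∈_; ∣_∣)
open import Data.Vec using (tabulate)
open import Data.List using (List; []; _∷_; length; removeAt; map; concatMap; upTo)
open import Data.List.Relation.Unary.All using (All)
open import Data.List.Relation.Unary.Any using (Any)
open import Data.Maybe using (Maybe; just; nothing)
open import Data.Product using (_×_)
open import Data.Integer using (+_)
open import Data.Rational using (ℚ; _+_; _-_; _≤_; _/_)
open import Relation.Binary.PropositionalEquality using (_≢_)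
open import Relation.Nullary using (¬_)
open import Data.Empty using (⊥)
open import Data.Unit using (⊤)

ℕ→ℚ : ℕ → ℚ
ℕ→ℚ n = (+ n) / 1

ℚ∞ : Set
ℚ∞ = Maybe ℚ

-∞ : ℚ∞
-∞ = nothing

_+∞_ : ℚ∞ → ℚ∞ → ℚ∞
just a +∞ just b = just (a + b)
_ +∞ _ = nothing

_≤∞_ : ℚ∞ → ℚ∞ → Set
nothing ≤∞ _ = ⊤
just a ≤∞ nothing = ⊥
just a ≤∞ just b = a Data.Rational.≤ b

-- E ⊂ ⋃_{u ∈ U} binom(u,2) for E = binom(V,2), V = Fin d
CoversAllPairs : {d : ℕ} → List (Subset d) → Set
CoversAllPairs {d} U = (i j : Fin d) → i ≢ j → Any (λ u → i ∈ u × j ∈ u) U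

IsCover : {d : ℕ} → List (Subset d) → Set
IsCover U =
  All (λ u → 2 Data.Nat.≤ ∣ u ∣) U
  × ((k : Fin (length U)) → ¬ CoversAllPairs (removeAt U k))
  × CoversAllPairs U

value : {d : ℕ} → (ℕ → ℚ∞) → List (Subset d) → ℚ∞
value Δ [] = just (ℕ→ℚ 0)
value Δ (u ∷ U) = (Δ ∣ u ∣ +∞ just (ℕ→ℚ 1 - ℕ→ℚ ∣ u ∣)) +∞ value Δ U

-- Δ_ℓ = δ for 2 ≤ ℓ ≤ d-1, Δ_d = -∞ (other indices unused since |u| ∈ [2,d])
ΔLemma5 : ℕ → ℚ → ℕ → ℚ∞
ΔLemma5 d δ ℓ = if ℓ ≡ᵇ d then nothing else just δ

subsetBy : (d : ℕ) → (ℕ → Bool) → Subset d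
subsetBy d p = tabulate (λ j → p (toℕ j))

pairSet : (d : ℕ) → ℕ → ℕ → Subset d
pairSet d i j = subsetBy d (λ k → (k ≡ᵇ i) ∨ (k ≡ᵇ j))

-- {1,…,d-1} (0-indexed: {0,…,d-2})
bigBlock : (d : ℕ) → Subset d
bigBlock d = subsetBy d (λ k → Data.Nat._<ᵇ_ k (d ∸ 1))

cover₁ : (d : ℕ) → List (Subset d)
cover₁ d = bigBlock d ∷ map (λ i → pairSet d i (d ∸ 1)) (upTo (d ∸ 1))

cover₂ : (d : ℕ) → List (Subset d)
cover₂ d = concatMap (λ j → map (λ i → pairSet d i j) (upTo j)) (upTo d)

{-# OPTIONS --safe #-}
-- For a cover U with m blocks of total size K the objective is m (1 + δ) − K, or −∞ as soon as
-- a block is all of V; so let 2 ≤ |u| ≤ d − 1 for every block. The blocks contain all C(d,2) pairs and k (k − 1) + 2d ≤ dk + 2 for 2 ≤ k ≤ d − 1, so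
-- dK ≥ 2 C(d,2) + 2 (d − 1) m. Deleting points one at a time gives Σ (|u| − 1) ≥ 2d − 3 for a
-- cover by proper blocks, i.e. K ≥ 2d − 3 + m. Finally K ≥ 2m. Hence the objective is at most a
-- concave piecewise-linear function of m with breakpoints m = d and m = C(d,2), where its values
-- are those of the star cover₁ and of the cover₂ by all pairs. Both are minimal because no pair
-- lies in two of their blocks: Σ C(|u|,2) = C(d,2), so one block fewer covers too few pairs.
module Submission where

open import Defs
open import Data.Bool using (false; T; _∨_; if_then_else_)
open import Data.Bool.Properties using (T-∨; T-≡)
open import Data.Empty using (⊥-elim)
open import Data.Fin using (Fin; zero; suc; toℕ)
import Data.Fin.Properties as Fin
open import Data.Fin.Subset using (Subset; _∈_; ∣_∣; ⊥; inside; outside)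
open import Data.Fin.Subset.Properties using (∣⊥∣≡0; ∣p∣≤n; drop-there)
open import Data.List using (List; []; _∷_; _++_; [_]; length; map; lookup; removeAt; upTo; concatMap)
import Data.List.Properties as List
open import Data.List.Membership.Propositional using (find)
open import Data.List.Membership.Propositional.Properties using (∈-lookup)
open import Data.List.Relation.Unary.All as All using (All; []; _∷_)
import Data.List.Relation.Unary.All.Properties as Allₚ
open import Data.List.Relation.Unary.Any as Any using (Any; here; there; any?)
import Data.List.Relation.Unary.Any.Properties as Anyₚ
open import Data.Maybe using (just; nothing)
import Data.Nat
open import Data.Nat as ℕ using (ℕ; zero; suc; z≤n; s≤s)
import Data.Nat.Properties as ℕ
open import Data.Nat.Combinatorics using (_C_; nC1≡n; nCk+nC[k+1]≡[n+1]C[k+1])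
open import Data.Product using (_×_; _,_; swap)
open import Data.Sum using (_⊎_; inj₁; inj₂)
open import Data.Unit using (tt)
open import Data.Vec using (_∷_; tail)
open import Data.Vec.Properties using (lookup⇒[]=; lookup∘tabulate)
open import Function using (id; _∘_; Equivalence)
open import Relation.Binary.Definitions using (tri<; tri≈; tri>)
open import Relation.Binary.PropositionalEquality
  using (_≡_; _≢_; refl; sym; trans; cong; cong₂; subst; subst₂; module ≡-Reasoning)
open import Relation.Nullary using (¬_; yes; no)
open import Relation.Nullary.Decidable using (dec-true; dec-false)

module _ where
  open import Data.Nat
  open import Data.Nat.Properties
  open import Data.Nat.Solver using (module +-*-Solver)
  open +-*-Solver

  ∑ : {A : Set} → (A → ℕ) → List A → ℕ
  ∑ f []       = 0
  ∑ f (x ∷ xs) = f x + ∑ f xs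

  module _ {A : Set} where

    ∑-+ : (f g : A → ℕ) (xs : List A) → ∑ (λ x → f x + g x) xs ≡ ∑ f xs + ∑ g xs
    ∑-+ f g []       = refl
    ∑-+ f g (x ∷ xs) rewrite ∑-+ f g xs =
      solve 4 (λ a b c d → (a :+ b) :+ (c :+ d) := (a :+ c) :+ (b :+ d)) refl
        (f x) (g x) (∑ f xs) (∑ g xs)

    ∑-*ˡ : (c : ℕ) (f : A → ℕ) (xs : List A) → ∑ (λ x → c * f x) xs ≡ c * ∑ f xs
    ∑-*ˡ c f []       = sym (*-zeroʳ c)
    ∑-*ˡ c f (x ∷ xs) rewrite ∑-*ˡ c f xs = sym (*-distribˡ-+ c (f x) (∑ f xs))

    ∑-const : (c : ℕ) (xs : List A) → ∑ (λ _ → c) xs ≡ c * length xs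
    ∑-const c []       = sym (*-zeroʳ c)
    ∑-const c (x ∷ xs) rewrite ∑-const c xs = sym (*-suc c (length xs))

    ∑-map : {B : Set} (f : B → ℕ) (g : A → B) (xs : List A) → ∑ f (map g xs) ≡ ∑ (f ∘ g) xs
    ∑-map f g []       = refl
    ∑-map f g (x ∷ xs) = cong (f (g x) +_) (∑-map f g xs)

    ∑-cong : {f g : A → ℕ} {xs : List A} → All (λ x → f x ≡ g x) xs → ∑ f xs ≡ ∑ g xs
    ∑-cong []         = refl
    ∑-cong (eq ∷ eqs) = cong₂ _+_ eq (∑-cong eqs)

    ∑-mono-≤ : {f g : A → ℕ} {xs : List A} → All (λ x → f x ≤ g x) xs → ∑ f xs ≤ ∑ g xs
    ∑-mono-≤ []         = z≤n
    ∑-mono-≤ (le ∷ les) = +-mono-≤ le (∑-mono-≤ les)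

    ∑-≥-Any : {c : ℕ} {f : A → ℕ} {xs : List A} → Any (λ x → c ≤ f x) xs → c ≤ ∑ f xs
    ∑-≥-Any (here le) = ≤-trans le (m≤m+n _ _)
    ∑-≥-Any (there a) = ≤-trans (∑-≥-Any a) (m≤n+m _ _)

    ∑-mono-≤-gap : {c : ℕ} {f g : A → ℕ} {xs : List A} →
      All (λ x → f x ≤ g x) xs → Any (λ x → f x + c ≤ g x) xs → ∑ f xs + c ≤ ∑ g xs
    ∑-mono-≤-gap {c} {f} {g} {x ∷ xs} (_ ∷ les) (here gap) = begin
      (f x + ∑ f xs) + c ≡⟨ solve 3 (λ a b c → (a :+ b) :+ c := (a :+ c) :+ b) refl (f x) (∑ f xs) c ⟩
      (f x + c) + ∑ f xs ≤⟨ +-mono-≤ gap (∑-mono-≤ les) ⟩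
      g x + ∑ g xs       ∎
      where open ≤-Reasoning
    ∑-mono-≤-gap {c} {f} {g} {x ∷ xs} (le ∷ les) (there gap) = begin
      (f x + ∑ f xs) + c ≡⟨ +-assoc (f x) (∑ f xs) c ⟩
      f x + (∑ f xs + c) ≤⟨ +-mono-≤ le (∑-mono-≤-gap les gap) ⟩
      g x + ∑ g xs       ∎
      where open ≤-Reasoning

    ∑-removeAt : (f : A → ℕ) (xs : List A) (k : Fin (length xs)) →
      ∑ f xs ≡ f (lookup xs k) + ∑ f (removeAt xs k)
    ∑-removeAt f (x ∷ xs) zero    = refl
    ∑-removeAt f (x ∷ xs) (suc k) rewrite ∑-removeAt f xs k =
      solve 3 (λ a b c → a :+ (b :+ c) := b :+ (a :+ c)) refl
        (f x) (f (lookup xs k)) (∑ f (removeAt xs k))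

  [1+n]C2≡n+nC2 : ∀ n → suc n C 2 ≡ n + n C 2
  [1+n]C2≡n+nC2 n = trans (sym (nCk+nC[k+1]≡[n+1]C[k+1] n 1)) (cong (_+ n C 2) (nC1≡n n))

  2*nC2+n≡n*n : ∀ n → 2 * (n C 2) + n ≡ n * n
  2*nC2+n≡n*n zero    = refl
  2*nC2+n≡n*n (suc n) = begin
    2 * (suc n C 2) + suc n         ≡⟨ cong (λ c → 2 * c + suc n) ([1+n]C2≡n+nC2 n) ⟩
    2 * (n + n C 2) + suc n         ≡⟨ solve 2 (λ n c → con 2 :* (n :+ c) :+ (con 1 :+ n)
                                                      := (con 2 :* c :+ n) :+ (con 1 :+ con 2 :* n))
                                               refl n (n C 2) ⟩
    (2 * (n C 2) + n) + (1 + 2 * n) ≡⟨ cong (_+ (1 + 2 * n)) (2*nC2+n≡n*n n) ⟩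
    n * n + (1 + 2 * n)             ≡⟨ solve 1 (λ n → n :* n :+ (con 1 :+ con 2 :* n)
                                                    := (con 1 :+ n) :* (con 1 :+ n)) refl n ⟩
    suc n * suc n                   ∎
    where open ≡-Reasoning

  2≤n⇒1≤nC2 : ∀ {n} → 2 ≤ n → 1 ≤ n C 2
  2≤n⇒1≤nC2 {suc n} (s≤s 1≤n) =
    ≤-trans 1≤n (≤-trans (m≤m+n n (n C 2)) (≤-reflexive (sym ([1+n]C2≡n+nC2 n))))

  -- This is (k − 2) (d − 1 − k) ≥ 0: with k = 2 + a and d = 1 + k + b the slack is a * b.
  2*kC2+2*d≤d*k+2 : ∀ {k d} → 2 ≤ k → k < d → 2 * (k C 2) + 2 * d ≤ d * k + 2
  2*kC2+2*d≤d*k+2 {k} {d} 2≤k k<d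
    with a , refl ← m≤n⇒∃[o]m+o≡n 2≤k | b , refl ← m≤n⇒∃[o]m+o≡n k<d =
    +-cancelʳ-≤ k _ _ (begin
      2 * (k C 2) + 2 * d + k   ≡⟨ solve 3 (λ c k d → c :+ con 2 :* d :+ k := (c :+ k) :+ con 2 :* d)
                                           refl (2 * (k C 2)) k d ⟩
      2 * (k C 2) + k + 2 * d   ≡⟨ cong (_+ 2 * d) (2*nC2+n≡n*n k) ⟩
      k * k + 2 * d             ≤⟨ m≤m+n (k * k + 2 * d) (a * b) ⟩
      k * k + 2 * d + a * b     ≡⟨ solve 2 (λ a b → let k = con 2 :+ a in
                                              k :* k :+ con 2 :* (con 1 :+ k :+ b) :+ a :* b
                                           := (con 1 :+ k :+ b) :* k :+ con 2 :+ k) refl a b ⟩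
      d * k + 2 + k             ∎)
    where open ≤-Reasoning

  ∣head∣ : ∀ {n} → Subset (suc n) → ℕ
  ∣head∣ (inside  ∷ _) = 1
  ∣head∣ (outside ∷ _) = 0

  link₀ : ∀ {n} → Subset (suc n) → Subset n
  link₀ (inside  ∷ p) = p
  link₀ (outside ∷ p) = ⊥

  ∣∣≡∣head∣+∣tail∣ : ∀ {n} (u : Subset (suc n)) → ∣ u ∣ ≡ ∣head∣ u + ∣ tail u ∣
  ∣∣≡∣head∣+∣tail∣ (inside  ∷ p) = refl
  ∣∣≡∣head∣+∣tail∣ (outside ∷ p) = refl

  ∣∣C2≡∣link₀∣+∣tail∣C2 : ∀ {n} (u : Subset (suc n)) → ∣ u ∣ C 2 ≡ ∣ link₀ u ∣ + ∣ tail u ∣ C 2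
  ∣∣C2≡∣link₀∣+∣tail∣C2 (inside  ∷ p) = [1+n]C2≡n+nC2 ∣ p ∣
  ∣∣C2≡∣link₀∣+∣tail∣C2 {n} (outside ∷ p) rewrite ∣⊥∣≡0 n = refl

  zero∈⇒1≤∣head∣ : ∀ {n} {u : Subset (suc n)} → zero ∈ u → 1 ≤ ∣head∣ u
  zero∈⇒1≤∣head∣ {u = inside ∷ p} _ = s≤s z≤n

  suc∈⇒∈tail : ∀ {n} {x : Fin n} {u : Subset (suc n)} → suc x ∈ u → x ∈ tail u
  suc∈⇒∈tail {u = _ ∷ _} = drop-there

  ∈link₀ : ∀ {n} {x : Fin n} {u : Subset (suc n)} → zero ∈ u → suc x ∈ u → x ∈ link₀ u
  ∈link₀ {u = inside ∷ p} _ x∈u = drop-there x∈u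

  covers-points⇒n≤∑∣∣ : ∀ {n} (U : List (Subset n)) → (∀ x → Any (x ∈_) U) → n ≤ ∑ ∣_∣ U
  covers-points⇒n≤∑∣∣ {zero}  _ _ = z≤n
  covers-points⇒n≤∑∣∣ {suc n} U cov = begin
    1 + n                               ≤⟨ +-mono-≤ (∑-≥-Any (Any.map zero∈⇒1≤∣head∣ (cov zero))) tails ⟩
    ∑ ∣head∣ U + ∑ (∣_∣ ∘ tail) U       ≡⟨ ∑-+ ∣head∣ (∣_∣ ∘ tail) U ⟨
    ∑ (λ u → ∣head∣ u + ∣ tail u ∣) U   ≡⟨ ∑-cong (All.universal ∣∣≡∣head∣+∣tail∣ U) ⟨
    ∑ ∣_∣ U                             ∎
    where
    open ≤-Reasoning
    tails : n ≤ ∑ (∣_∣ ∘ tail) U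
    tails = subst (n ≤_) (∑-map ∣_∣ tail U)
      (covers-points⇒n≤∑∣∣ (map tail U) (λ x → Anyₚ.map⁺ (Any.map suc∈⇒∈tail (cov (suc x)))))

  tails-cover-pairs : ∀ {n} {U : List (Subset (suc n))} → CoversAllPairs U → CoversAllPairs (map tail U)
  tails-cover-pairs cov i j i≢j = Anyₚ.map⁺ (Any.map (λ (i∈u , j∈u) → suc∈⇒∈tail i∈u , suc∈⇒∈tail j∈u)
    (cov (suc i) (suc j) (i≢j ∘ Fin.suc-injective)))

  covers⇒n≤∑∣link₀∣ : ∀ {n} (U : List (Subset (suc n))) → CoversAllPairs U → n ≤ ∑ (∣_∣ ∘ link₀) U
  covers⇒n≤∑∣link₀∣ {n} U cov = subst (n ≤_) (∑-map ∣_∣ link₀ U) (covers-points⇒n≤∑∣∣ (map link₀ U)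
    (λ x → Anyₚ.map⁺ (Any.map (λ (0∈u , x∈u) → ∈link₀ 0∈u x∈u) (cov zero (suc x) (λ ())))))

  pairCount : ∀ {n} → List (Subset n) → ℕ
  pairCount = ∑ (λ u → ∣ u ∣ C 2)

  covers⇒nC2≤pairCount : ∀ {n} (U : List (Subset n)) → CoversAllPairs U → n C 2 ≤ pairCount U
  covers⇒nC2≤pairCount {zero}  _ _ = z≤n
  covers⇒nC2≤pairCount {suc n} U cov = begin
    suc n C 2                                        ≡⟨ [1+n]C2≡n+nC2 n ⟩
    n + n C 2                                        ≤⟨ +-mono-≤ (covers⇒n≤∑∣link₀∣ U cov) tails ⟩
    ∑ (∣_∣ ∘ link₀) U + ∑ (λ u → ∣ tail u ∣ C 2) U   ≡⟨ ∑-+ (∣_∣ ∘ link₀) (λ u → ∣ tail u ∣ C 2) U ⟨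
    ∑ (λ u → ∣ link₀ u ∣ + ∣ tail u ∣ C 2) U         ≡⟨ ∑-cong (All.universal ∣∣C2≡∣link₀∣+∣tail∣C2 U) ⟨
    pairCount U                                      ∎
    where
    open ≤-Reasoning
    tails : n C 2 ≤ ∑ (λ u → ∣ tail u ∣ C 2) U
    tails = subst (n C 2 ≤_) (∑-map (λ u → ∣ u ∣ C 2) tail U)
      (covers⇒nC2≤pairCount (map tail U) (tails-cover-pairs cov))

  pairCount≤nC2⇒IsCover : ∀ {n} (U : List (Subset n)) → All (λ u → 2 ≤ ∣ u ∣) U → CoversAllPairs U →
    pairCount U ≤ n C 2 → IsCover U
  pairCount≤nC2⇒IsCover {n} U 2≤∣u∣ cov tight = 2≤∣u∣ , minimal , cov
    where
    minimal : (k : Fin (length U)) → ¬ CoversAllPairs (removeAt U k)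
    minimal k cov′ = 1+n≰n (begin
      suc (n C 2)                                    ≤⟨ +-mono-≤ (2≤n⇒1≤nC2 (All.lookup 2≤∣u∣ (∈-lookup k)))
                                                                 (covers⇒nC2≤pairCount (removeAt U k) cov′) ⟩
      ∣ lookup U k ∣ C 2 + pairCount (removeAt U k)  ≡⟨ ∑-removeAt (λ u → ∣ u ∣ C 2) U k ⟨
      pairCount U                                    ≤⟨ tight ⟩
      n C 2                                          ∎)
      where open ≤-Reasoning

  excess : ∀ {n} → Subset n → ℕ
  excess u = ∣ u ∣ ∸ 1

  meets₀ : ∀ {n} → Subset (suc n) → ℕ
  meets₀ u = 1 ⊓ ∣ link₀ u ∣

  excess≡meets₀+excess-tail : ∀ {n} (u : Subset (suc n)) → excess u ≡ meets₀ u + excess (tail u)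
  excess≡meets₀+excess-tail (inside  ∷ p) = sym (m⊓n+n∸m≡n 1 ∣ p ∣)
  excess≡meets₀+excess-tail {n} (outside ∷ p) rewrite ∣⊥∣≡0 n = refl

  ∣link₀∣≤excess : ∀ {n} (u : Subset (suc n)) → ∣ link₀ u ∣ ≤ excess u
  ∣link₀∣≤excess (inside  ∷ p) = ≤-refl
  ∣link₀∣≤excess {n} (outside ∷ p) rewrite ∣⊥∣≡0 n = z≤n

  full-tail⇒∣link₀∣+k≤excess : ∀ {k} (u : Subset (suc (suc k))) → ∣ u ∣ ≤ suc k → ∣ tail u ∣ ≡ suc k →
    ∣ link₀ u ∣ + k ≤ excess u
  full-tail⇒∣link₀∣+k≤excess (inside  ∷ p) ∣u∣≤1+k ∣p∣≡1+k =
    ⊥-elim (1+n≰n (subst (λ c → suc c ≤ _) ∣p∣≡1+k ∣u∣≤1+k))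
  full-tail⇒∣link₀∣+k≤excess {k} (outside ∷ p) _ ∣p∣≡1+k rewrite ∣⊥∣≡0 (suc k) | ∣p∣≡1+k = ≤-refl

  m≤n⇒m≤n*[1⊓m] : ∀ {m n} → m ≤ n → m ≤ n * (1 ⊓ m)
  m≤n⇒m≤n*[1⊓m] {zero}      _   = z≤n
  m≤n⇒m≤n*[1⊓m] {suc m} {n} m≤n = subst (suc m ≤_) (sym (*-identityʳ n)) m≤n

  1+n≤n*m⇒2≤m : ∀ {n m} → suc n ≤ n * m → 2 ≤ m
  1+n≤n*m⇒2≤m {n} {zero}        le = ⊥-elim (1+n≰n (≤-trans le (≤-trans (≤-reflexive (*-zeroʳ n)) z≤n)))
  1+n≤n*m⇒2≤m {n} {suc zero}    le = ⊥-elim (1+n≰n (≤-trans le (≤-reflexive (*-identityʳ n))))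
  1+n≤n*m⇒2≤m {n} {suc (suc m)} _  = s≤s (s≤s z≤n)

  -- Delete the point 0. If some block is everything but 0, it alone has excess n − 1 and the links
  -- of the blocks through 0 cover the other n points. Otherwise the tails form a cover of n points
  -- by proper blocks, and at least two blocks meet 0 in a pair, as each link has at most n − 1 points.
  covers⇒2n≤1+∑excess : ∀ n (U : List (Subset (suc n))) → CoversAllPairs U → All (λ u → ∣ u ∣ ≤ n) U →
    2 * n ≤ suc (∑ excess U)
  covers⇒2n≤1+∑excess zero    _ _ _ = z≤n
  covers⇒2n≤1+∑excess (suc k) U cov proper with any? (λ u → ∣ tail u ∣ ≟ suc k) U
  ... | yes full = begin
    2 * suc k                    ≡⟨ solve 1 (λ k → con 2 :* (con 1 :+ k) := con 1 :+ ((con 1 :+ k) :+ k)) refl k ⟩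
    suc (suc k + k)              ≤⟨ s≤s (+-monoˡ-≤ k (covers⇒n≤∑∣link₀∣ U cov)) ⟩
    suc (∑ (∣_∣ ∘ link₀) U + k)  ≤⟨ s≤s (∑-mono-≤-gap (All.universal ∣link₀∣≤excess U) gap) ⟩
    suc (∑ excess U)             ∎
    where
    open ≤-Reasoning
    gap : Any (λ u → ∣ link₀ u ∣ + k ≤ excess u) U
    gap with u , u∈U , ∣tail∣≡1+k ← find full =
      Any.map (λ { refl → full-tail⇒∣link₀∣+k≤excess u (All.lookup proper u∈U) ∣tail∣≡1+k }) u∈U
  ... | no ¬full = begin
    2 * suc k                                     ≡⟨ solve 1 (λ k → con 2 :* (con 1 :+ k) := con 2 :+ con 2 :* k)
                                                              refl k ⟩
    2 + 2 * k                                     ≤⟨ +-mono-≤ 2≤∑meets₀ (covers⇒2n≤1+∑excess k (map tail U)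
                                                                            (tails-cover-pairs cov) tails-proper) ⟩
    ∑ meets₀ U + suc (∑ excess (map tail U))      ≡⟨ +-suc _ _ ⟩
    suc (∑ meets₀ U + ∑ excess (map tail U))      ≡⟨ cong (λ s → suc (∑ meets₀ U + s)) (∑-map excess tail U) ⟩
    suc (∑ meets₀ U + ∑ (excess ∘ tail) U)        ≡⟨ cong suc (∑-+ meets₀ (excess ∘ tail) U) ⟨
    suc (∑ (λ u → meets₀ u + excess (tail u)) U)  ≡⟨ cong suc (∑-cong (All.universal excess≡meets₀+excess-tail U)) ⟨
    suc (∑ excess U)                              ∎
    where
    open ≤-Reasoning
    tails-proper : All (λ p → ∣ p ∣ ≤ k) (map tail U)
    tails-proper = Allₚ.map⁺ (All.map (λ {u} ≢1+k → m<1+n⇒m≤n (≤∧≢⇒< (∣p∣≤n (tail u)) ≢1+k))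
                                      (Allₚ.¬Any⇒All¬ U ¬full))
    ∣link₀∣≤k*meets₀ : All (λ u → ∣ link₀ u ∣ ≤ k * meets₀ u) U
    ∣link₀∣≤k*meets₀ =
      All.map (λ {u} ∣u∣≤1+k → m≤n⇒m≤n*[1⊓m] (≤-trans (∣link₀∣≤excess u) (∸-monoˡ-≤ 1 ∣u∣≤1+k))) proper
    2≤∑meets₀ : 2 ≤ ∑ meets₀ U
    2≤∑meets₀ = 1+n≤n*m⇒2≤m (begin
      suc k                     ≤⟨ covers⇒n≤∑∣link₀∣ U cov ⟩
      ∑ (∣_∣ ∘ link₀) U         ≤⟨ ∑-mono-≤ ∣link₀∣≤k*meets₀ ⟩
      ∑ (λ u → k * meets₀ u) U  ≡⟨ ∑-*ˡ k meets₀ U ⟩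
      k * ∑ meets₀ U            ∎)

  pair-constraint : ∀ {n} (U : List (Subset (suc n))) → CoversAllPairs U →
    All (λ u → 2 ≤ ∣ u ∣) U → All (λ u → ∣ u ∣ ≤ n) U →
    2 * (suc n C 2) + 2 * suc n * length U ≤ suc n * ∑ ∣_∣ U + 2 * length U
  pair-constraint {n} U cov 2≤∣u∣ ∣u∣≤n = begin
    2 * (d C 2) + 2 * d * m                          ≤⟨ +-monoˡ-≤ (2 * d * m) (*-monoʳ-≤ 2 (covers⇒nC2≤pairCount U cov)) ⟩
    2 * pairCount U + 2 * d * m                      ≡⟨ cong₂ _+_ (∑-*ˡ 2 (λ u → ∣ u ∣ C 2) U) (∑-const (2 * d) U) ⟨
    ∑ (λ u → 2 * (∣ u ∣ C 2)) U + ∑ (λ _ → 2 * d) U  ≡⟨ ∑-+ (λ u → 2 * (∣ u ∣ C 2)) (λ _ → 2 * d) U ⟨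
    ∑ (λ u → 2 * (∣ u ∣ C 2) + 2 * d) U              ≤⟨ ∑-mono-≤ (All.zipWith (λ (2≤k , k≤n) → 2*kC2+2*d≤d*k+2 2≤k (s≤s k≤n))
                                                                             (2≤∣u∣ , ∣u∣≤n)) ⟩
    ∑ (λ u → d * ∣ u ∣ + 2) U                        ≡⟨ ∑-+ (λ u → d * ∣ u ∣) (λ _ → 2) U ⟩
    ∑ (λ u → d * ∣ u ∣) U + ∑ (λ _ → 2) U            ≡⟨ cong₂ _+_ (∑-*ˡ d ∣_∣ U) (∑-const 2 U) ⟩
    d * ∑ ∣_∣ U + 2 * m                              ∎
    where
    open ≤-Reasoning
    d = suc n
    m = length U

  pair-constraint′ : ∀ {n} (U : List (Subset (suc n))) → CoversAllPairs U →
    All (λ u → 2 ≤ ∣ u ∣) U → All (λ u → ∣ u ∣ ≤ n) U →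
    suc n * suc n + 2 * suc n * length U ≤ suc n * ∑ ∣_∣ U + 2 * length U + suc n
  pair-constraint′ {n} U cov 2≤∣u∣ ∣u∣≤n = begin
    d * d + 2 * d * m            ≡⟨ cong (_+ 2 * d * m) (2*nC2+n≡n*n d) ⟨
    2 * (d C 2) + d + 2 * d * m  ≡⟨ solve 3 (λ c d x → c :+ d :+ x := c :+ x :+ d) refl (2 * (d C 2)) d (2 * d * m) ⟩
    2 * (d C 2) + 2 * d * m + d  ≤⟨ +-monoˡ-≤ d (pair-constraint U cov 2≤∣u∣ ∣u∣≤n) ⟩
    d * ∑ ∣_∣ U + 2 * m + d      ∎
    where
    open ≤-Reasoning
    d = suc n
    m = length U

  excess-constraint : ∀ {n} (U : List (Subset (suc n))) → CoversAllPairs U →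
    All (λ u → 1 ≤ ∣ u ∣) U → All (λ u → ∣ u ∣ ≤ n) U →
    2 * suc n + length U ≤ ∑ ∣_∣ U + 3
  excess-constraint {n} U cov 1≤∣u∣ ∣u∣≤n = begin
    2 * suc n + m    ≡⟨ solve 2 (λ n m → con 2 :* (con 1 :+ n) :+ m := con 2 :* n :+ (con 2 :+ m)) refl n m ⟩
    2 * n + (2 + m)  ≤⟨ +-monoˡ-≤ (2 + m) (covers⇒2n≤1+∑excess n U cov ∣u∣≤n) ⟩
    suc E + (2 + m)  ≡⟨ solve 2 (λ E m → (con 1 :+ E) :+ (con 2 :+ m) := (E :+ m) :+ con 3) refl E m ⟩
    (E + m) + 3      ≡⟨ cong (_+ 3) ∑∣∣≡E+m ⟨
    ∑ ∣_∣ U + 3      ∎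
    where
    open ≤-Reasoning
    m = length U
    E = ∑ excess U
    ∑∣∣≡E+m : ∑ ∣_∣ U ≡ E + m
    ∑∣∣≡E+m = begin-equality
      ∑ ∣_∣ U                   ≡⟨ ∑-cong (All.map (λ 1≤k → sym (m∸n+n≡m 1≤k)) 1≤∣u∣) ⟩
      ∑ (λ u → excess u + 1) U  ≡⟨ ∑-+ excess (λ _ → 1) U ⟩
      E + ∑ (λ _ → 1) U         ≡⟨ cong (E +_) (trans (∑-const 1 U) (*-identityˡ m)) ⟩
      E + m                     ∎

  size-constraint : ∀ {n} (U : List (Subset n)) → All (λ u → 2 ≤ ∣ u ∣) U → 2 * length U ≤ ∑ ∣_∣ U
  size-constraint U 2≤∣u∣ = subst (_≤ ∑ ∣_∣ U) (∑-const 2 U) (∑-mono-≤ 2≤∣u∣)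

  ∈-subsetBy : ∀ {d} p {x : Fin d} → T (p (toℕ x)) → x ∈ subsetBy d p
  ∈-subsetBy {d} p {x} px =
    lookup⇒[]= x (subsetBy d p) (trans (lookup∘tabulate (p ∘ toℕ) x) (Equivalence.to T-≡ px))

  ∈-pairSetˡ : ∀ {d} (x : Fin d) j → x ∈ pairSet d (toℕ x) j
  ∈-pairSetˡ x j = ∈-subsetBy (λ k → (k ≡ᵇ toℕ x) ∨ (k ≡ᵇ j))
    (Equivalence.from T-∨ (inj₁ (≡⇒≡ᵇ (toℕ x) (toℕ x) refl)))

  ∈-pairSetʳ : ∀ {d} i (x : Fin d) → x ∈ pairSet d i (toℕ x)
  ∈-pairSetʳ i x = ∈-subsetBy (λ k → (k ≡ᵇ i) ∨ (k ≡ᵇ toℕ x))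
    (Equivalence.from T-∨ (inj₂ (≡⇒≡ᵇ (toℕ x) (toℕ x) refl)))

  ∈-bigBlock : ∀ {d} {x : Fin d} → toℕ x < d ∸ 1 → x ∈ bigBlock d
  ∈-bigBlock {d} x<d-1 = ∈-subsetBy (_<ᵇ d ∸ 1) (<⇒<ᵇ x<d-1)

  ∣subsetBy-false∣ : ∀ d → ∣ subsetBy d (λ _ → false) ∣ ≡ 0
  ∣subsetBy-false∣ zero    = refl
  ∣subsetBy-false∣ (suc d) = ∣subsetBy-false∣ d

  ∣subsetBy-≡ᵇ∣ : ∀ {d j} → j < d → ∣ subsetBy d (_≡ᵇ j) ∣ ≡ 1
  ∣subsetBy-≡ᵇ∣ {suc d} {zero}  _         = cong suc (∣subsetBy-false∣ d)
  ∣subsetBy-≡ᵇ∣ {suc d} {suc j} (s≤s j<d) = ∣subsetBy-≡ᵇ∣ j<d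

  ∣pairSet∣ : ∀ {d i j} → i < j → j < d → ∣ pairSet d i j ∣ ≡ 2
  ∣pairSet∣ {suc d} {zero}  {suc j} _         (s≤s j<d) = cong suc (∣subsetBy-≡ᵇ∣ j<d)
  ∣pairSet∣ {suc d} {suc i} {suc j} (s≤s i<j) (s≤s j<d) = ∣pairSet∣ i<j j<d

  ∣subsetBy-<ᵇ∣ : ∀ {d c} → c ≤ d → ∣ subsetBy d (_<ᵇ c) ∣ ≡ c
  ∣subsetBy-<ᵇ∣ {d}     {zero}  _         = ∣subsetBy-false∣ d
  ∣subsetBy-<ᵇ∣ {suc d} {suc c} (s≤s c≤d) = cong suc (∣subsetBy-<ᵇ∣ c≤d)

  ordered-pairs⇒CoversAllPairs : ∀ {d} {U : List (Subset d)} →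
    (∀ (a b : Fin d) → toℕ a < toℕ b → Any (λ u → a ∈ u × b ∈ u) U) → CoversAllPairs U
  ordered-pairs⇒CoversAllPairs ordered i j i≢j with <-cmp (toℕ i) (toℕ j)
  ... | tri< i<j _ _ = ordered i j i<j
  ... | tri≈ _ i≡j _ = ⊥-elim (i≢j (Fin.toℕ-injective i≡j))
  ... | tri> _ _ j<i = Any.map swap (ordered j i j<i)

  spokes : ∀ n → List (Subset (suc n))
  spokes n = map (λ i → pairSet (suc n) i n) (upTo n)

  ∣spokes∣≡2 : ∀ n → All (λ u → ∣ u ∣ ≡ 2) (spokes n)
  ∣spokes∣≡2 n = Allₚ.map⁺ (Allₚ.applyUpTo⁺₁ id n (λ i<n → ∣pairSet∣ i<n (n<1+n n)))

  length-spokes : ∀ n → length (spokes n) ≡ n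
  length-spokes n = trans (List.length-map _ (upTo n)) (List.length-upTo n)

  cover₁-covers : ∀ n → CoversAllPairs (cover₁ (suc n))
  cover₁-covers n = ordered-pairs⇒CoversAllPairs covers
    where
    covers : ∀ a b → toℕ a < toℕ b → Any (λ u → a ∈ u × b ∈ u) (cover₁ (suc n))
    covers a b a<b with toℕ b <? n
    ... | yes b<n = here (∈-bigBlock (<-trans a<b b<n) , ∈-bigBlock b<n)
    ... | no  b≮n = there (Anyₚ.map⁺ (Anyₚ.applyUpTo⁺ id (∈-pairSetˡ a n , b∈spoke) (≤-trans a<b (≤-reflexive b≡n))))
      where
      b≡n : toℕ b ≡ n
      b≡n = ≤-antisym (m<1+n⇒m≤n (Fin.toℕ<n b)) (≮⇒≥ b≮n)
      b∈spoke : b ∈ pairSet (suc n) (toℕ a) n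
      b∈spoke = subst (λ k → b ∈ pairSet (suc n) (toℕ a) k) b≡n (∈-pairSetʳ (toℕ a) b)

  pairCount-cover₁ : ∀ n → pairCount (cover₁ (suc n)) ≡ suc n C 2
  pairCount-cover₁ n = begin
    ∣ bigBlock (suc n) ∣ C 2 + pairCount (spokes n)  ≡⟨ cong₂ (λ k s → k C 2 + s) (∣subsetBy-<ᵇ∣ (n≤1+n n))
                                                              (∑-cong (All.map (cong (_C 2)) (∣spokes∣≡2 n))) ⟩
    n C 2 + ∑ (λ _ → 1) (spokes n)                   ≡⟨ cong (n C 2 +_) (trans (∑-const 1 (spokes n))
                                                                            (trans (*-identityˡ _) (length-spokes n))) ⟩
    n C 2 + n                                        ≡⟨ +-comm (n C 2) n ⟩
    n + n C 2                                        ≡⟨ [1+n]C2≡n+nC2 n ⟨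
    suc n C 2                                        ∎
    where open ≡-Reasoning

  IsCover-cover₁ : ∀ {n} → 2 ≤ n → IsCover (cover₁ (suc n))
  IsCover-cover₁ {n} 2≤n = pairCount≤nC2⇒IsCover (cover₁ (suc n))
    (subst (2 ≤_) (sym (∣subsetBy-<ᵇ∣ (n≤1+n n))) 2≤n ∷ All.map (≤-reflexive ∘ sym) (∣spokes∣≡2 n))
    (cover₁-covers n)
    (≤-reflexive (pairCount-cover₁ n))

  ∣cover₂∣≡2 : ∀ d → All (λ u → ∣ u ∣ ≡ 2) (cover₂ d)
  ∣cover₂∣≡2 d = Allₚ.concat⁺ (Allₚ.map⁺ (Allₚ.applyUpTo⁺₁ id d (λ {j} j<d →
    Allₚ.map⁺ (Allₚ.applyUpTo⁺₁ id j (λ i<j → ∣pairSet∣ i<j j<d)))))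

  length-triangle : ∀ {B : Set} (f : ℕ → ℕ → B) k →
    length (concatMap (λ j → map (λ i → f i j) (upTo j)) (upTo k)) ≡ k C 2
  length-triangle f zero    = refl
  length-triangle f (suc k) = begin
    length (concatMap row (upTo (suc k)))                   ≡⟨ cong (length ∘ concatMap row) (List.upTo-∷ʳ k) ⟨
    length (concatMap row (upTo k ++ [ k ]))                ≡⟨ cong length (List.concatMap-++ row (upTo k) [ k ]) ⟩
    length (concatMap row (upTo k) ++ concatMap row [ k ])  ≡⟨ List.length-++ (concatMap row (upTo k)) ⟩
    length (concatMap row (upTo k)) + length (row k ++ [])  ≡⟨ cong₂ _+_ (length-triangle f k)
                                                                         (cong length (List.++-identityʳ (row k))) ⟩
    k C 2 + length (row k)                                  ≡⟨ cong (k C 2 +_) (trans (List.length-map _ (upTo k))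
                                                                                      (List.length-upTo k)) ⟩
    k C 2 + k                                               ≡⟨ +-comm (k C 2) k ⟩
    k + k C 2                                               ≡⟨ [1+n]C2≡n+nC2 k ⟨
    suc k C 2                                               ∎
    where
    open ≡-Reasoning
    row = λ j → map (λ i → f i j) (upTo j)

  pairCount-cover₂ : ∀ d → pairCount (cover₂ d) ≡ d C 2
  pairCount-cover₂ d = begin
    pairCount (cover₂ d)    ≡⟨ ∑-cong (All.map (cong (_C 2)) (∣cover₂∣≡2 d)) ⟩
    ∑ (λ _ → 1) (cover₂ d)  ≡⟨ ∑-const 1 (cover₂ d) ⟩
    1 * length (cover₂ d)   ≡⟨ *-identityˡ _ ⟩
    length (cover₂ d)       ≡⟨ length-triangle (pairSet d) d ⟩
    d C 2                   ∎
    where open ≡-Reasoning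

  cover₂-covers : ∀ d → CoversAllPairs (cover₂ d)
  cover₂-covers d = ordered-pairs⇒CoversAllPairs λ a b a<b → Anyₚ.concatMap⁺ _
    (Anyₚ.applyUpTo⁺ id (Anyₚ.map⁺ (Anyₚ.applyUpTo⁺ id (∈-pairSetˡ a (toℕ b) , ∈-pairSetʳ (toℕ a) b) a<b))
                        (Fin.toℕ<n b))

  IsCover-cover₂ : ∀ d → IsCover (cover₂ d)
  IsCover-cover₂ d = pairCount≤nC2⇒IsCover (cover₂ d)
    (All.map (≤-reflexive ∘ sym) (∣cover₂∣≡2 d))
    (cover₂-covers d)
    (≤-reflexive (pairCount-cover₂ d))

module _ where
  open import Data.Integer as ℤ using (+_)
  import Data.Integer.Properties as ℤ
  import Data.Nat.Coprimality as Coprime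
  open import Data.Rational
    using (ℚ; mkℚ; _/_; 0ℚ; 1ℚ; _+_; _*_; _-_; -_; _≤_; _<_; _⊔_; *≤*; positive; nonNegative; nonPositive)
  open import Data.Rational.Properties
  open import Data.Rational.Solver using (module +-*-Solver)
  open +-*-Solver

  ℕ→ℚ≡mkℚ : ∀ n → ℕ→ℚ n ≡ mkℚ (+ n) 0 (Coprime.sym (Coprime.1-coprimeTo n))
  ℕ→ℚ≡mkℚ n = ↥p/↧p≡p (mkℚ (+ n) 0 (Coprime.sym (Coprime.1-coprimeTo n)))

  ℕ→ℚ-homo-+ : ∀ m n → ℕ→ℚ (m ℕ.+ n) ≡ ℕ→ℚ m + ℕ→ℚ n
  ℕ→ℚ-homo-+ m n rewrite ℕ→ℚ≡mkℚ m | ℕ→ℚ≡mkℚ n =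
    cong (_/ 1) (sym (cong₂ ℤ._+_ (ℤ.*-identityʳ (+ m)) (ℤ.*-identityʳ (+ n))))

  ℕ→ℚ-homo-* : ∀ m n → ℕ→ℚ (m ℕ.* n) ≡ ℕ→ℚ m * ℕ→ℚ n
  ℕ→ℚ-homo-* m n rewrite ℕ→ℚ≡mkℚ m | ℕ→ℚ≡mkℚ n = cong (_/ 1) (ℤ.pos-* m n)

  ℕ→ℚ-mono-≤ : ∀ {m n} → m ℕ.≤ n → ℕ→ℚ m ≤ ℕ→ℚ n
  ℕ→ℚ-mono-≤ {m} {n} m≤n rewrite ℕ→ℚ≡mkℚ m | ℕ→ℚ≡mkℚ n =
    *≤* (subst₂ ℤ._≤_ (sym (ℤ.*-identityʳ (+ m))) (sym (ℤ.*-identityʳ (+ n))) (ℤ.+≤+ m≤n))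

  ℕ→ℚ-pos : ∀ n → 0ℚ < ℕ→ℚ (suc n)
  ℕ→ℚ-pos n = positive⁻¹ (ℕ→ℚ (suc n)) {{normalize-pos (suc n) 1}}

  infixl 6 _⊕_
  infixl 7 _⊗_

  -- Syntax for the ℕ-polynomials in which the counting inequalities are transported to ℚ.
  data Poly : Set where
    `_      : ℕ → Poly
    _⊕_ _⊗_ : Poly → Poly → Poly

  ⟦_⟧ℕ : Poly → ℕ
  ⟦ ` n   ⟧ℕ = n
  ⟦ p ⊕ q ⟧ℕ = ⟦ p ⟧ℕ ℕ.+ ⟦ q ⟧ℕ
  ⟦ p ⊗ q ⟧ℕ = ⟦ p ⟧ℕ ℕ.* ⟦ q ⟧ℕ

  ⟦_⟧ℚ : Poly → ℚ
  ⟦ ` n   ⟧ℚ = ℕ→ℚ n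
  ⟦ p ⊕ q ⟧ℚ = ⟦ p ⟧ℚ + ⟦ q ⟧ℚ
  ⟦ p ⊗ q ⟧ℚ = ⟦ p ⟧ℚ * ⟦ q ⟧ℚ

  ℕ→ℚ-⟦⟧ : ∀ p → ℕ→ℚ ⟦ p ⟧ℕ ≡ ⟦ p ⟧ℚ
  ℕ→ℚ-⟦⟧ (` n)   = refl
  ℕ→ℚ-⟦⟧ (p ⊕ q) = trans (ℕ→ℚ-homo-+ ⟦ p ⟧ℕ ⟦ q ⟧ℕ) (cong₂ _+_ (ℕ→ℚ-⟦⟧ p) (ℕ→ℚ-⟦⟧ q))
  ℕ→ℚ-⟦⟧ (p ⊗ q) = trans (ℕ→ℚ-homo-* ⟦ p ⟧ℕ ⟦ q ⟧ℕ) (cong₂ _*_ (ℕ→ℚ-⟦⟧ p) (ℕ→ℚ-⟦⟧ q))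

  ⟦⟧-mono-≤ : ∀ p q → ⟦ p ⟧ℕ ℕ.≤ ⟦ q ⟧ℕ → ⟦ p ⟧ℚ ≤ ⟦ q ⟧ℚ
  ⟦⟧-mono-≤ p q le = subst₂ _≤_ (ℕ→ℚ-⟦⟧ p) (ℕ→ℚ-⟦⟧ q) (ℕ→ℚ-mono-≤ le)

  p≤q⇒p-q≤0 : ∀ {p q} → p ≤ q → p - q ≤ 0ℚ
  p≤q⇒p-q≤0 {p} {q} p≤q = subst (p - q ≤_) (+-inverseʳ q) (+-monoˡ-≤ (- q) p≤q)

  p≤q⇒0≤q-p : ∀ {p q} → p ≤ q → 0ℚ ≤ q - p
  p≤q⇒0≤q-p {p} {q} p≤q = subst (_≤ q - p) (+-inverseʳ p) (+-monoˡ-≤ (- p) p≤q)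

  opposite-signs⇒*≤0 : ∀ {s t} → (0ℚ ≤ s × t ≤ 0ℚ) ⊎ (s ≤ 0ℚ × 0ℚ ≤ t) → s * t ≤ 0ℚ
  opposite-signs⇒*≤0 {s} {t} (inj₁ (0≤s , t≤0)) =
    nonPositive⁻¹ _ {{nonNeg*nonPos⇒nonPos s {{nonNegative 0≤s}} t {{nonPositive t≤0}}}}
  opposite-signs⇒*≤0 {s} {t} (inj₂ (s≤0 , 0≤t)) =
    nonPositive⁻¹ _ {{nonPos*nonNeg⇒nonPos s {{nonPositive s≤0}} t {{nonNegative 0≤t}}}}

  ≤-by-slope : ∀ {D v T a b} s t → 0ℚ < D → a ≤ b → s * t ≤ 0ℚ →
    D * v + (b - a) ≡ s * t + D * T → v ≤ T
  ≤-by-slope {D} {v} {T} {a} {b} s t 0<D a≤b st≤0 eq = *-cancelˡ-≤-pos D {{positive 0<D}} (begin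
    D * v            ≡⟨ +-identityʳ (D * v) ⟨
    D * v + 0ℚ       ≤⟨ +-monoʳ-≤ (D * v) (p≤q⇒0≤q-p a≤b) ⟩
    D * v + (b - a)  ≡⟨ eq ⟩
    s * t + D * T    ≤⟨ +-monoˡ-≤ (D * T) st≤0 ⟩
    0ℚ + D * T       ≡⟨ +-identityˡ (D * T) ⟩
    D * T            ∎)
    where open ≤-Reasoning

  -- The bound is concave and piecewise linear in m, with breakpoints d and N. Each case walks from
  -- m to the nearer breakpoint along one constraint; d (δ − 1) + 2 is d times the slope along the
  -- first one.
  linear-bound : ∀ {δ d m K N} → 0ℚ ≤ δ → δ ≤ 1ℚ → 0ℚ < d →
    ℕ→ℚ 2 * N + ℕ→ℚ 2 * d * m ≤ d * K + ℕ→ℚ 2 * m →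
    d * d + ℕ→ℚ 2 * d * m ≤ d * K + ℕ→ℚ 2 * m + d →
    ℕ→ℚ 2 * d + m ≤ K + ℕ→ℚ 3 →
    ℕ→ℚ 2 * m ≤ K →
    (m * δ + m) - K ≤ ((δ * d - ℕ→ℚ 2 * d) + ℕ→ℚ 3) ⊔ (N * δ - N)
  linear-bound {δ} {d} {m} {K} {N} 0≤δ δ≤1 0<d pairs pairs′ proper sizes
    with ≤-total (d * (δ - 1ℚ) + ℕ→ℚ 2) 0ℚ
  ... | inj₁ s≤0 = ≤-trans (bound (≤-total m d)) (p≤p⊔q ((δ * d - ℕ→ℚ 2 * d) + ℕ→ℚ 3) (N * δ - N))
    where
    bound : m ≤ d ⊎ d ≤ m → (m * δ + m) - K ≤ (δ * d - ℕ→ℚ 2 * d) + ℕ→ℚ 3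
    bound (inj₁ m≤d) = ≤-by-slope δ (m - d) (positive⁻¹ 1ℚ) proper
      (opposite-signs⇒*≤0 (inj₁ (0≤δ , p≤q⇒p-q≤0 m≤d)))
      (solve 4 (λ δ d m K →
          con 1ℚ :* ((m :* δ :+ m) :- K) :+ ((K :+ con (ℕ→ℚ 3)) :- (con (ℕ→ℚ 2) :* d :+ m))
        := δ :* (m :- d) :+ con 1ℚ :* ((δ :* d :- con (ℕ→ℚ 2) :* d) :+ con (ℕ→ℚ 3)))
        refl δ d m K)
    bound (inj₂ d≤m) = ≤-by-slope (d * (δ - 1ℚ) + ℕ→ℚ 2) (m - d) 0<d pairs′
      (opposite-signs⇒*≤0 (inj₂ (s≤0 , p≤q⇒0≤q-p d≤m)))
      (solve 4 (λ δ d m K →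
          d :* ((m :* δ :+ m) :- K) :+ ((d :* K :+ con (ℕ→ℚ 2) :* m :+ d) :- (d :* d :+ con (ℕ→ℚ 2) :* d :* m))
        := (d :* (δ :- con 1ℚ) :+ con (ℕ→ℚ 2)) :* (m :- d) :+ d :* ((δ :* d :- con (ℕ→ℚ 2) :* d) :+ con (ℕ→ℚ 3)))
        refl δ d m K)
  ... | inj₂ 0≤s = ≤-trans (bound (≤-total m N)) (p≤q⊔p ((δ * d - ℕ→ℚ 2 * d) + ℕ→ℚ 3) (N * δ - N))
    where
    bound : m ≤ N ⊎ N ≤ m → (m * δ + m) - K ≤ N * δ - N
    bound (inj₁ m≤N) = ≤-by-slope (d * (δ - 1ℚ) + ℕ→ℚ 2) (m - N) 0<d pairs
      (opposite-signs⇒*≤0 (inj₁ (0≤s , p≤q⇒p-q≤0 m≤N)))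
      (solve 5 (λ δ d m K N →
          d :* ((m :* δ :+ m) :- K) :+ ((d :* K :+ con (ℕ→ℚ 2) :* m) :- (con (ℕ→ℚ 2) :* N :+ con (ℕ→ℚ 2) :* d :* m))
        := (d :* (δ :- con 1ℚ) :+ con (ℕ→ℚ 2)) :* (m :- N) :+ d :* (N :* δ :- N))
        refl δ d m K N)
    bound (inj₂ N≤m) = ≤-by-slope (δ - 1ℚ) (m - N) (positive⁻¹ 1ℚ) sizes
      (opposite-signs⇒*≤0 (inj₂ (p≤q⇒p-q≤0 δ≤1 , p≤q⇒0≤q-p N≤m)))
      (solve 4 (λ δ m K N →
          con 1ℚ :* ((m :* δ :+ m) :- K) :+ (K :- con (ℕ→ℚ 2) :* m)
        := (δ :- con 1ℚ) :* (m :- N) :+ con 1ℚ :* (N :* δ :- N))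
        refl δ m K N)

  ΔLemma5-≢ : ∀ {d ℓ} δ → ℓ ≢ d → ΔLemma5 d δ ℓ ≡ just δ
  ΔLemma5-≢ {d} {ℓ} δ ℓ≢d = cong (if_then nothing else just δ) (dec-false (ℓ ℕ.≟ d) ℓ≢d)

  ΔLemma5-≡ : ∀ d δ → ΔLemma5 d δ d ≡ nothing
  ΔLemma5-≡ d δ = cong (if_then nothing else just δ) (dec-true (d ℕ.≟ d) refl)

  x+∞-∞≡-∞ : ∀ x → x +∞ -∞ ≡ -∞
  x+∞-∞≡-∞ (just x) = refl
  x+∞-∞≡-∞ nothing  = refl

  value-full : ∀ {d} δ (U : List (Subset d)) → Any (λ u → ∣ u ∣ ≡ d) U → value (ΔLemma5 d δ) U ≡ -∞
  value-full {d} δ (u ∷ U) (here ∣u∣≡d) rewrite ∣u∣≡d | ΔLemma5-≡ d δ = refl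
  value-full δ (u ∷ U) (there full) rewrite value-full δ U full = x+∞-∞≡-∞ _

  value-proper : ∀ {d} δ (U : List (Subset d)) → All (λ u → ∣ u ∣ ≢ d) U →
    value (ΔLemma5 d δ) U ≡ just ((ℕ→ℚ (length U) * δ + ℕ→ℚ (length U)) - ℕ→ℚ (∑ ∣_∣ U))
  value-proper δ []       []           =
    cong just (solve 1 (λ δ → con 0ℚ := con 0ℚ :* δ :+ con 0ℚ :- con 0ℚ) refl δ)
  value-proper δ (u ∷ U) (∣u∣≢d ∷ ≢d) rewrite ΔLemma5-≢ δ ∣u∣≢d | value-proper δ U ≢d = cong just (begin
    (δ + (ℕ→ℚ 1 - ℕ→ℚ ∣ u ∣)) + ((ℕ→ℚ m * δ + ℕ→ℚ m) - ℕ→ℚ K)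
      ≡⟨ solve 4 (λ δ k m K → (δ :+ (con (ℕ→ℚ 1) :- k)) :+ ((m :* δ :+ m) :- K)
                            := (con (ℕ→ℚ 1) :+ m) :* δ :+ (con (ℕ→ℚ 1) :+ m) :- (k :+ K))
                 refl δ (ℕ→ℚ ∣ u ∣) (ℕ→ℚ m) (ℕ→ℚ K) ⟩
    (⟦ ` 1 ⊕ ` m ⟧ℚ * δ + ⟦ ` 1 ⊕ ` m ⟧ℚ) - ⟦ ` ∣ u ∣ ⊕ ` K ⟧ℚ
      ≡⟨ cong₂ (λ a b → (a * δ + a) - b) (ℕ→ℚ-⟦⟧ (` 1 ⊕ ` m)) (ℕ→ℚ-⟦⟧ (` ∣ u ∣ ⊕ ` K)) ⟨
    (ℕ→ℚ (suc m) * δ + ℕ→ℚ (suc m)) - ℕ→ℚ (∣ u ∣ ℕ.+ K) ∎)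
    where
    open ≡-Reasoning
    m = length U
    K = ∑ ∣_∣ U

  value≤max : ∀ n δ → 0ℚ ≤ δ → δ ≤ 1ℚ → (U : List (Subset (suc n))) → IsCover U →
    let d = suc n in
    value (ΔLemma5 d δ) U ≤∞ just (((δ * ℕ→ℚ d - ℕ→ℚ (2 ℕ.* d)) + ℕ→ℚ 3) ⊔ ((ℕ→ℚ (d C 2) * δ) - ℕ→ℚ (d C 2)))
  value≤max n δ 0≤δ δ≤1 U (2≤∣u∣ , _ , cov) with any? (λ u → ∣ u ∣ ℕ.≟ suc n) U
  ... | yes full rewrite value-full δ U full = tt
  ... | no ¬full rewrite value-proper δ U (Allₚ.¬Any⇒All¬ U ¬full) | ℕ→ℚ-homo-* 2 (suc n) =
    linear-bound {δ} {ℕ→ℚ d} {ℕ→ℚ m} {ℕ→ℚ K} {ℕ→ℚ N} 0≤δ δ≤1 (ℕ→ℚ-pos n)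
      (⟦⟧-mono-≤ (` 2 ⊗ ` N ⊕ ` 2 ⊗ ` d ⊗ ` m) (` d ⊗ ` K ⊕ ` 2 ⊗ ` m)
                 (pair-constraint U cov 2≤∣u∣ ∣u∣≤n))
      (⟦⟧-mono-≤ (` d ⊗ ` d ⊕ ` 2 ⊗ ` d ⊗ ` m) (` d ⊗ ` K ⊕ ` 2 ⊗ ` m ⊕ ` d)
                 (pair-constraint′ U cov 2≤∣u∣ ∣u∣≤n))
      (⟦⟧-mono-≤ (` 2 ⊗ ` d ⊕ ` m) (` K ⊕ ` 3)
                 (excess-constraint U cov (All.map (ℕ.≤-trans (s≤s z≤n)) 2≤∣u∣) ∣u∣≤n))
      (⟦⟧-mono-≤ (` 2 ⊗ ` m) (` K) (size-constraint U 2≤∣u∣))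
    where
    d = suc n
    m = length U
    K = ∑ ∣_∣ U
    N = d C 2
    ∣u∣≤n : All (λ u → ∣ u ∣ ℕ.≤ n) U
    ∣u∣≤n = All.map (λ {u} ∣u∣≢d → ℕ.m<1+n⇒m≤n (ℕ.≤∧≢⇒< (∣p∣≤n u) ∣u∣≢d)) (Allₚ.¬Any⇒All¬ U ¬full)

  value-cover₁ : ∀ {n} δ → 2 ℕ.≤ n →
    value (ΔLemma5 (suc n) δ) (cover₁ (suc n)) ≡ just ((δ * ℕ→ℚ (suc n) - ℕ→ℚ (2 ℕ.* suc n)) + ℕ→ℚ 3)
  value-cover₁ {n} δ 2≤n = trans (value-proper δ (cover₁ (suc n)) ≢d) (cong just (begin
    (ℕ→ℚ (suc (length (spokes n))) * δ + ℕ→ℚ (suc (length (spokes n))))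
      - ℕ→ℚ (∣ bigBlock (suc n) ∣ ℕ.+ ∑ ∣_∣ (spokes n))
      ≡⟨ cong₂ (λ m K → (ℕ→ℚ (suc m) * δ + ℕ→ℚ (suc m)) - ℕ→ℚ K) (length-spokes n) K≡n+2*n ⟩
    (ℕ→ℚ (suc n) * δ + ℕ→ℚ (suc n)) - ℕ→ℚ (n ℕ.+ 2 ℕ.* n)
      ≡⟨ cong₂ (λ d K → (d * δ + d) - K) (ℕ→ℚ-⟦⟧ (` 1 ⊕ ` n)) (ℕ→ℚ-⟦⟧ (` n ⊕ ` 2 ⊗ ` n)) ⟩
    (⟦ ` 1 ⊕ ` n ⟧ℚ * δ + ⟦ ` 1 ⊕ ` n ⟧ℚ) - ⟦ ` n ⊕ ` 2 ⊗ ` n ⟧ℚ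
      ≡⟨ solve 2 (λ n δ → ((con (ℕ→ℚ 1) :+ n) :* δ :+ (con (ℕ→ℚ 1) :+ n)) :- (n :+ con (ℕ→ℚ 2) :* n)
                       := (δ :* (con (ℕ→ℚ 1) :+ n) :- con (ℕ→ℚ 2) :* (con (ℕ→ℚ 1) :+ n)) :+ con (ℕ→ℚ 3))
                 refl (ℕ→ℚ n) δ ⟩
    (δ * ⟦ ` 1 ⊕ ` n ⟧ℚ - ⟦ ` 2 ⊗ (` 1 ⊕ ` n) ⟧ℚ) + ℕ→ℚ 3
      ≡⟨ cong₂ (λ d 2d → (δ * d - 2d) + ℕ→ℚ 3) (ℕ→ℚ-⟦⟧ (` 1 ⊕ ` n)) (ℕ→ℚ-⟦⟧ (` 2 ⊗ (` 1 ⊕ ` n))) ⟨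
    (δ * ℕ→ℚ (suc n) - ℕ→ℚ (2 ℕ.* suc n)) + ℕ→ℚ 3 ∎))
    where
    open ≡-Reasoning
    ≢d : All (λ u → ∣ u ∣ ≢ suc n) (cover₁ (suc n))
    ≢d = (λ ∣u∣≡d → ℕ.1+n≰n (ℕ.≤-reflexive (trans (sym ∣u∣≡d) (∣subsetBy-<ᵇ∣ (ℕ.n≤1+n n)))))
       ∷ All.map (λ ∣u∣≡2 ∣u∣≡d → ℕ.1+n≰n (ℕ.≤-trans 2≤n (ℕ.≤-reflexive (ℕ.suc-injective (trans (sym ∣u∣≡d) ∣u∣≡2)))))
                 (∣spokes∣≡2 n)
    K≡n+2*n : ∣ bigBlock (suc n) ∣ ℕ.+ ∑ ∣_∣ (spokes n) ≡ n ℕ.+ 2 ℕ.* n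
    K≡n+2*n = cong₂ ℕ._+_ (∣subsetBy-<ᵇ∣ (ℕ.n≤1+n n))
      (trans (∑-cong (∣spokes∣≡2 n)) (trans (∑-const 2 (spokes n)) (cong (2 ℕ.*_) (length-spokes n))))

  value-cover₂ : ∀ {d} δ → 3 ℕ.≤ d → value (ΔLemma5 d δ) (cover₂ d) ≡ just (ℕ→ℚ (d C 2) * δ - ℕ→ℚ (d C 2))
  value-cover₂ {d} δ 3≤d = trans (value-proper δ (cover₂ d) ≢d) (cong just (begin
    (ℕ→ℚ m * δ + ℕ→ℚ m) - ℕ→ℚ (∑ ∣_∣ (cover₂ d))  ≡⟨ cong (λ K → (ℕ→ℚ m * δ + ℕ→ℚ m) - ℕ→ℚ K) K≡2*m ⟩
    (ℕ→ℚ m * δ + ℕ→ℚ m) - ℕ→ℚ (2 ℕ.* m)          ≡⟨ cong (λ K → (ℕ→ℚ m * δ + ℕ→ℚ m) - K) (ℕ→ℚ-homo-* 2 m) ⟩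
    (ℕ→ℚ m * δ + ℕ→ℚ m) - ℕ→ℚ 2 * ℕ→ℚ m          ≡⟨ solve 2 (λ m δ → (m :* δ :+ m) :- con (ℕ→ℚ 2) :* m
                                                                   := m :* δ :- m) refl (ℕ→ℚ m) δ ⟩
    ℕ→ℚ m * δ - ℕ→ℚ m                            ≡⟨ cong (λ k → ℕ→ℚ k * δ - ℕ→ℚ k) (length-triangle (pairSet d) d) ⟩
    ℕ→ℚ (d C 2) * δ - ℕ→ℚ (d C 2)                ∎))
    where
    open ≡-Reasoning
    m = length (cover₂ d)
    ≢d : All (λ u → ∣ u ∣ ≢ d) (cover₂ d)
    ≢d = All.map (λ ∣u∣≡2 ∣u∣≡d → ℕ.1+n≰n (ℕ.≤-trans 3≤d (ℕ.≤-reflexive (trans (sym ∣u∣≡d) ∣u∣≡2))))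
                 (∣cover₂∣≡2 d)
    K≡2*m : ∑ ∣_∣ (cover₂ d) ≡ 2 ℕ.* m
    K≡2*m = trans (∑-cong (∣cover₂∣≡2 d)) (∑-const 2 (cover₂ d))

  lemma5 : (d : ℕ) → 3 Data.Nat.≤ d → (δ : ℚ) → ℕ→ℚ 0 < δ → δ < ℕ→ℚ 1 →
    let M = ((δ * ℕ→ℚ d - ℕ→ℚ (2 Data.Nat.* d)) + ℕ→ℚ 3)
              ⊔ ((ℕ→ℚ (d C 2) * δ) - ℕ→ℚ (d C 2))
    in IsCover (cover₁ d) × IsCover (cover₂ d)
       × ((U : List (Subset d)) → IsCover U → value (ΔLemma5 d δ) U ≤∞ just M)
       × (value (ΔLemma5 d δ) (cover₁ d) ≡ just M ⊎ value (ΔLemma5 d δ) (cover₂ d) ≡ just M)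
  lemma5 (suc n) 3≤d@(s≤s 2≤n) δ 0<δ δ<1 =
    IsCover-cover₁ 2≤n , IsCover-cover₂ (suc n) , value≤max n δ (<⇒≤ 0<δ) (<⇒≤ δ<1) , attained (≤-total A B)
    where
    A = (δ * ℕ→ℚ (suc n) - ℕ→ℚ (2 ℕ.* suc n)) + ℕ→ℚ 3
    B = ℕ→ℚ (suc n C 2) * δ - ℕ→ℚ (suc n C 2)
    attained : A ≤ B ⊎ B ≤ A →
      value (ΔLemma5 (suc n) δ) (cover₁ (suc n)) ≡ just (A ⊔ B) ⊎ value (ΔLemma5 (suc n) δ) (cover₂ (suc n)) ≡ just (A ⊔ B)
    attained (inj₁ A≤B) = inj₂ (trans (value-cover₂ δ 3≤d) (cong just (sym (p≤q⇒p⊔q≡q A≤B))))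
    attained (inj₂ B≤A) = inj₁ (trans (value-cover₁ δ 2≤n) (cong just (sym (p≥q⇒p⊔q≡p B≤A))))
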